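{- Let $c$ be a prime of the form $2^r\cdot 3+1$ ($r$ a positive integer), and let $a,b$ be integers greater than $1$ such that $a,b,c$ are pairwise relatively prime and $e_c(a)=e_c(b)=3$. Let $z,Y,Z$ be positive integers with $z\le Z$, $Y\equiv 4\pmod 6$, $a+b=c^z$ and $a+b^Y=c^Z$. Then $a^{Y-1}\equiv -1\pmod{c^z}$ and $c^{Yz-Z}\equiv 1\pmod a$.
   Context: For a positive integer $M$ and an integer $A$ coprime to $M$, $e_M(A)$ is the least positive integer $e$ such that $A^e\equiv 1$ or $A^e\equiv-1\pmod M$. -}

module Defs where

open import Data.Nat using (ℕ; _<_)
open import Data.Integer using (ℤ; +_; _^_; _-_; _+_; 1ℤ)
open import Data.Integer.Divisibility using (_∣_)
open import Data.Product using (_×_)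
open import Data.Sum using (_⊎_)
open import Relation.Nullary using (¬_)

PlusMinusOne : ℕ → ℤ → Set
PlusMinusOne M X = ((+ M) ∣ (X - 1ℤ)) ⊎ ((+ M) ∣ (X + 1ℤ))

-- IsOrd± M A e  :  e = e_M(A), i.e. e is the least positive integer with
-- A^e ≡ 1 or A^e ≡ -1 (mod M).
IsOrd± : ℕ → ℤ → ℕ → Set
IsOrd± M A e =
  (0 < e) × PlusMinusOne M (A ^ e) ×
  ((d : ℕ) → 0 < d → d < e → ¬ PlusMinusOne M (A ^ d))

-- Modulo c^z we have b ≡ -a, so for even Y the relation a + b^Y = c^Z with z ≤ Z gives
-- a + a^Y ≡ 0, i.e. c^z ∣ a (a^(Y-1) + 1), and a is a unit mod c^z.  Modulo a we have
-- b ≡ c^z, so c^(Yz) ≡ b^Y ≡ c^Z, i.e. a ∣ c^Z (c^(Yz-Z) - 1), and c is a unit mod a.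
module Submission where

open import Defs
open import Data.Nat using (ℕ; _<_; _≤_; _∸_) renaming (_+_ to _+ℕ_; _*_ to _*ℕ_; _^_ to _^ℕ_; _%_ to _%ℕ_)
open import Data.Nat.Primality using (Prime)
open import Data.Nat.Coprimality using (Coprime)
open import Data.Integer using (ℤ; +_; _^_; _-_; _+_; 1ℤ)
open import Data.Integer.Divisibility using (_∣_)
open import Data.Product using (_×_)
open import Relation.Binary.PropositionalEquality using (_≡_)

open import Data.Nat using (suc; s≤s; z≤n; _/_; _≤?_)
import Data.Nat.Properties as ℕ
import Data.Nat.Divisibility as ℕ
import Data.Nat.DivMod as ℕ
import Data.Nat.Coprimality as ℕ
import Data.Nat.Tactic.RingSolver as ℕ-Solver
open import Data.Integer using (-_; _*_; ∣_∣)
open import Data.Integer.Properties using (pos-+; pos-*; abs-*; ^-*-assoc; ^-distribˡ-+-*)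
import Data.Integer.Coprimality as ℤ
open import Data.Integer.Divisibility.Signed as Signed
  using (divides; ∣⇒∣ᵤ; ∣ᵤ⇒∣; ∣-refl; ∣-reflexive; ∣-trans; ∣m∣n⇒∣m+n; ∣m∣n⇒∣m-n; ∣n⇒∣m*n)
open import Data.Integer.Tactic.RingSolver using (solve-∀)
open import Data.Product using (∃; _,_; proj₁; proj₂)
open import Relation.Nullary using (yes; no)
open import Relation.Binary.PropositionalEquality using (refl; sym; trans; cong; subst; subst₂; module ≡-Reasoning)

pos-^ : ∀ m n → + (m ^ℕ n) ≡ (+ m) ^ n
pos-^ m 0       = refl
pos-^ m (suc n) = trans (pos-* m (m ^ℕ n)) (cong (+ m *_) (pos-^ m n))

abs-^ : ∀ i n → ∣ i ^ n ∣ ≡ ∣ i ∣ ^ℕ n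
abs-^ i 0       = refl
abs-^ i (suc n) = trans (abs-* i (i ^ n)) (cong (∣ i ∣ *ℕ_) (abs-^ i n))

x^m∣x^n : ∀ x {m n} → m ≤ n → x ^ℕ m ℕ.∣ x ^ℕ n
x^m∣x^n x {m} {n} m≤n = ℕ.divides (x ^ℕ (n ∸ m)) (begin
  x ^ℕ n                    ≡⟨ cong (x ^ℕ_) (ℕ.m+[n∸m]≡n m≤n) ⟨
  x ^ℕ (m +ℕ (n ∸ m))       ≡⟨ ℕ.^-distribˡ-+-* x m (n ∸ m) ⟩
  x ^ℕ m *ℕ x ^ℕ (n ∸ m)    ≡⟨ ℕ.*-comm (x ^ℕ m) (x ^ℕ (n ∸ m)) ⟩
  x ^ℕ (n ∸ m) *ℕ x ^ℕ m    ∎)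
  where open ≡-Reasoning

coprime-^ʳ : ∀ {m n} k → Coprime m n → Coprime m (n ^ℕ k)
coprime-^ʳ 0       _       (_ , d∣1)     = ℕ.∣1⇒≡1 d∣1
coprime-^ʳ (suc k) m⊥n {d} (d∣m , d∣nⁿ⁺¹) = coprime-^ʳ k m⊥n (d∣m , ℕ.coprime-divisor d⊥n d∣nⁿ⁺¹)
  where
  d⊥n : Coprime d _
  d⊥n (e∣d , e∣n) = m⊥n (ℕ.∣-trans e∣d d∣m , e∣n)

ℤ-coprime-^ʳ : ∀ {i j} n → ℤ.Coprime i j → ℤ.Coprime i (j ^ n)
ℤ-coprime-^ʳ {i} {j} n i⊥j = subst (Coprime ∣ i ∣) (sym (abs-^ j n)) (coprime-^ʳ n i⊥j)

n%6≡4⇒even : ∀ n → n %ℕ 6 ≡ 4 → ∃ λ t → n ≡ 2 *ℕ t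
n%6≡4⇒even n n%6≡4 = 2 +ℕ (n / 6) *ℕ 3 , (begin
  n                          ≡⟨ ℕ.m≡m%n+[m/n]*n n 6 ⟩
  n %ℕ 6 +ℕ (n / 6) *ℕ 6     ≡⟨ cong (_+ℕ (n / 6) *ℕ 6) n%6≡4 ⟩
  4 +ℕ (n / 6) *ℕ 6          ≡⟨ regroup (n / 6) ⟩
  2 *ℕ (2 +ℕ (n / 6) *ℕ 3)   ∎)
  where
  open ≡-Reasoning
  regroup : ∀ q → 4 +ℕ q *ℕ 6 ≡ 2 *ℕ (2 +ℕ q *ℕ 3)
  regroup = ℕ-Solver.solve-∀

x-y∣xⁿ-yⁿ : ∀ x y n → (x - y) Signed.∣ (x ^ n - y ^ n)
x-y∣xⁿ-yⁿ x y 0       = divides (+ 0) refl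
x-y∣xⁿ-yⁿ x y (suc n) =
  subst (x - y Signed.∣_) (telescope x y (x ^ n) (y ^ n))
    (∣m∣n⇒∣m+n (∣n⇒∣m*n x (x-y∣xⁿ-yⁿ x y n)) (∣n⇒∣m*n (y ^ n) ∣-refl))
  where
  telescope : ∀ x y u v → x * (u - v) + v * (x - y) ≡ x * u - y * v
  telescope = solve-∀

x+y∣x²ᵗ-y²ᵗ : ∀ x y t → (x + y) Signed.∣ (x ^ (2 *ℕ t) - y ^ (2 *ℕ t))
x+y∣x²ᵗ-y²ᵗ x y t = subst₂ Signed._∣_ (x-[-y]≡x+y x y) (cong (λ u → x ^ (2 *ℕ t) - u) (-y^2t≡y^2t))
  (x-y∣xⁿ-yⁿ x (- y) (2 *ℕ t))
  where
  open ≡-Reasoning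
  x-[-y]≡x+y : ∀ x y → x - - y ≡ x + y
  x-[-y]≡x+y = solve-∀
  -- _^_ is unfolded here because the ring solver does not reflect it.
  [-y]²≡y² : ∀ y → (- y) * ((- y) * 1ℤ) ≡ y * (y * 1ℤ)
  [-y]²≡y² = solve-∀
  -y^2t≡y^2t : (- y) ^ (2 *ℕ t) ≡ y ^ (2 *ℕ t)
  -y^2t≡y^2t = begin
    (- y) ^ (2 *ℕ t)   ≡⟨ ^-*-assoc (- y) 2 t ⟨
    ((- y) ^ 2) ^ t    ≡⟨ cong (_^ t) ([-y]²≡y² y) ⟩
    (y ^ 2) ^ t        ≡⟨ ^-*-assoc y 2 t ⟩
    y ^ (2 *ℕ t)       ∎

x+y≡z⇒x∣z-y : ∀ {x y z} → x + y ≡ z → x Signed.∣ (z - y)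
x+y≡z⇒x∣z-y {x} {y} refl = ∣-reflexive (sym ([x+y]-y≡x x y))
  where
  [x+y]-y≡x : ∀ x y → (x + y) - y ≡ x
  [x+y]-y≡x = solve-∀

∣x+y∧∣x+yⁿ⇒∣xⁿ⁻¹+1 : ∀ {m x y} n t → 1 ≤ n → n ≡ 2 *ℕ t → ℤ.Coprime m x →
                     m Signed.∣ (x + y) → m Signed.∣ (x + y ^ n) → m ∣ (x ^ (n ∸ 1) + 1ℤ)
∣x+y∧∣x+yⁿ⇒∣xⁿ⁻¹+1 {m} {x} {y} (suc k) t (s≤s z≤n) n≡2t m⊥x m∣x+y m∣x+yⁿ =
  ℤ.coprime-divisor m x (x ^ k + 1ℤ) m⊥x (∣⇒∣ᵤ m∣x[xᵏ+1])
  where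
  n = suc k
  regroup : ∀ x yⁿ xᵏ → (x + yⁿ) + (x * xᵏ - yⁿ) ≡ x * (xᵏ + 1ℤ)
  regroup = solve-∀
  m∣xⁿ-yⁿ : m Signed.∣ (x ^ n - y ^ n)
  m∣xⁿ-yⁿ = subst (λ e → m Signed.∣ (x ^ e - y ^ e)) (sym n≡2t) (∣-trans m∣x+y (x+y∣x²ᵗ-y²ᵗ x y t))
  m∣x[xᵏ+1] : m Signed.∣ (x * (x ^ k + 1ℤ))
  m∣x[xᵏ+1] = subst (m Signed.∣_) (regroup x (y ^ n) (x ^ k)) (∣m∣n⇒∣m+n m∣x+yⁿ m∣xⁿ-yⁿ)

-- For Z > Yz the truncated exponent Yz ∸ Z is 0 and the claim degenerates to x ∣ 0.
∣zᵐ-y∧∣zᵖ-yⁿ⇒∣z^[nm∸p]-1 : ∀ {x y z} m n p → ℤ.Coprime x z →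
                           x Signed.∣ (z ^ m - y) → x Signed.∣ (z ^ p - y ^ n) →
                           x ∣ (z ^ (n *ℕ m ∸ p) - 1ℤ)
∣zᵐ-y∧∣zᵖ-yⁿ⇒∣z^[nm∸p]-1 {x} {y} {z} m n p x⊥z x∣zᵐ-y x∣zᵖ-yⁿ with p ≤? n *ℕ m
... | no p≰nm rewrite ℕ.m≤n⇒m∸n≡0 (ℕ.<⇒≤ (ℕ.≰⇒> p≰nm)) = (∣ x ∣) ℕ.∣0
... | yes p≤nm =
  ℤ.coprime-divisor x (z ^ p) (z ^ j - 1ℤ) (ℤ-coprime-^ʳ {x} {z} p x⊥z) (∣⇒∣ᵤ x∣zᵖ[zʲ-1])
  where
  open ≡-Reasoning
  j = n *ℕ m ∸ p
  [zᵐ]ⁿ≡zᵖzʲ : (z ^ m) ^ n ≡ z ^ p * z ^ j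
  [zᵐ]ⁿ≡zᵖzʲ = begin
    (z ^ m) ^ n       ≡⟨ ^-*-assoc z m n ⟩
    z ^ (m *ℕ n)      ≡⟨ cong (z ^_) (ℕ.*-comm m n) ⟩
    z ^ (n *ℕ m)      ≡⟨ cong (z ^_) (ℕ.m+[n∸m]≡n p≤nm) ⟨
    z ^ (p +ℕ j)      ≡⟨ ^-distribˡ-+-* z p j ⟩
    z ^ p * z ^ j     ∎
  cancel : ∀ u v w → (u * v - w) - (u - w) ≡ u * (v - 1ℤ)
  cancel = solve-∀
  x∣[zᵐ]ⁿ-yⁿ : x Signed.∣ ((z ^ m) ^ n - y ^ n)
  x∣[zᵐ]ⁿ-yⁿ = ∣-trans x∣zᵐ-y (x-y∣xⁿ-yⁿ (z ^ m) y n)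
  x∣zᵖ[zʲ-1] : x Signed.∣ (z ^ p * (z ^ j - 1ℤ))
  x∣zᵖ[zʲ-1] = subst (x Signed.∣_) (cancel (z ^ p) (z ^ j) (y ^ n))
    (∣m∣n⇒∣m-n (subst (λ w → x Signed.∣ (w - y ^ n)) [zᵐ]ⁿ≡zᵖzʲ x∣[zᵐ]ⁿ-yⁿ) x∣zᵖ-yⁿ)

lemma5p7 : (a b c r z Y Z : ℕ) →
    1 ≤ r → c ≡ (2 ^ℕ r) *ℕ 3 +ℕ 1 → Prime c →
    1 < a → 1 < b →
    Coprime a b → Coprime a c → Coprime b c →
    IsOrd± c (+ a) 3 → IsOrd± c (+ b) 3 →
    1 ≤ z → 1 ≤ Y → 1 ≤ Z → z ≤ Z →
    Y %ℕ 6 ≡ 4 →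
    a +ℕ b ≡ c ^ℕ z →
    a +ℕ b ^ℕ Y ≡ c ^ℕ Z →
    ((+ (c ^ℕ z)) ∣ ((+ a) ^ (Y ∸ 1) + 1ℤ)) ×
    ((+ a) ∣ ((+ c) ^ (Y *ℕ z ∸ Z) - 1ℤ))
lemma5p7 a b c _ z Y Z _ _ _ _ _ _ a⊥c _ _ _ _ 1≤Y _ z≤Z Y%6≡4 a+b≡cᶻ a+bʸ≡c^Z =
    ∣x+y∧∣x+yⁿ⇒∣xⁿ⁻¹+1 Y (proj₁ Y-even) 1≤Y (proj₂ Y-even) (ℕ.sym (coprime-^ʳ z a⊥c))
      (∣-reflexive (trans (pos-^ c z) (sym a+b≡cᶻ′)))
      (∣-trans (∣ᵤ⇒∣ (x^m∣x^n c z≤Z)) (∣-reflexive (trans (pos-^ c Z) (sym a+bʸ≡c^Z′))))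
  , ∣zᵐ-y∧∣zᵖ-yⁿ⇒∣z^[nm∸p]-1 {+ a} {+ b} {+ c} z Y Z a⊥c (x+y≡z⇒x∣z-y a+b≡cᶻ′) (x+y≡z⇒x∣z-y a+bʸ≡c^Z′)
  where
  Y-even : ∃ λ t → Y ≡ 2 *ℕ t
  Y-even = n%6≡4⇒even Y Y%6≡4
  toℤ : ∀ x y n → x +ℕ y ≡ c ^ℕ n → + x + + y ≡ (+ c) ^ n
  toℤ x y n eq = trans (sym (pos-+ x y)) (trans (cong +_ eq) (pos-^ c n))
  a+b≡cᶻ′ : + a + + b ≡ (+ c) ^ z
  a+b≡cᶻ′ = toℤ a b z a+b≡cᶻ
  a+bʸ≡c^Z′ : + a + (+ b) ^ Y ≡ (+ c) ^ Z
  a+bʸ≡c^Z′ = trans (cong (λ u → + a + u) (sym (pos-^ b Y))) (toℤ a (b ^ℕ Y) Z a+bʸ≡c^Z)
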